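{- Let $m\geq 8$ be even and let $n$ be a positive integer with $n\equiv 2 \pmod{m/2}$. Then for every tree $T_n$ on $n$ vertices with maximum degree $\Delta(T_n)=n-3$, we have $R(T_n,W_m)\geq 2n+m/2-4$.
   Context: All graphs are finite, simple, undirected. For graphs $G,H$, the Ramsey number $R(G,H)$ is the smallest positive integer $N$ such that for every graph $F$ on $N$ vertices, either $F$ contains a subgraph isomorphic to $G$ or the complement $\overline{F}$ contains a subgraph isomorphic to $H$. $W_m$ is the wheel on $m+1$ vertices: a cycle $C_m$ plus one extra vertex adjacent to all vertices of the cycle. -}

module Defs where

open import Data.Nat using (ℕ; zero; suc; _+_; _*_; _∸_; _≤_; _<_)
open import Data.Nat.Base using (_≡ᵇ_)
open import Data.Fin using (Fin; toℕ; zero; suc; _≟_)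
open import Data.Bool using (Bool; true; false; not; _∧_; _∨_; if_then_else_)
open import Data.List using (List; map; allFin)
open import Data.Nat.ListAction using (sum)
open import Data.Product using (Σ; ∃; _×_; _,_)
open import Data.Sum using (_⊎_)
open import Relation.Nullary using (¬_)
open import Relation.Nullary.Decidable using (⌊_⌋)
open import Relation.Binary.PropositionalEquality using (_≡_; _≢_)
open import Function.Definitions using (Injective)

Graph : ℕ → Set
Graph k = Fin k → Fin k → Bool

IsSimple : ∀ {k} → Graph k → Set
IsSimple {k} G = (∀ u v → G u v ≡ G v u) × (∀ v → G v v ≡ false)

complement : ∀ {k} → Graph k → Graph k
complement G u v = not (G u v) ∧ not ⌊ u ≟ v ⌋

Contains : ∀ {p N} → Graph N → Graph p → Set
Contains {p} {N} F G =
  Σ (Fin p → Fin N) λ f → Injective _≡_ _≡_ f × (∀ u v → G u v ≡ true → F (f u) (f v) ≡ true)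

-- The cycle C_k on vertices 0,…,k-1 (intended for k ≥ 3): i ~ i+1 and 0 ~ k-1.
cycle : (k : ℕ) → Graph k
cycle k i j =
  (suc (toℕ i) ≡ᵇ toℕ j) ∨ (suc (toℕ j) ≡ᵇ toℕ i)
  ∨ ((toℕ i ≡ᵇ 0) ∧ (suc (toℕ j) ≡ᵇ k)) ∨ ((toℕ j ≡ᵇ 0) ∧ (suc (toℕ i) ≡ᵇ k))

-- The wheel W_m on m+1 vertices: hub = zero, rim = suc i forming C_m.
wheel : (m : ℕ) → Graph (suc m)
wheel m zero zero = false
wheel m zero (suc j) = true
wheel m (suc i) zero = true
wheel m (suc i) (suc j) = cycle m i j

data Reachable {k} (G : Graph k) : Fin k → Fin k → Set where
  here : ∀ {v} → Reachable G v v
  step : ∀ {u w v} → G u w ≡ true → Reachable G w v → Reachable G u v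

Connected : ∀ {k} → Graph k → Set
Connected G = ∀ u v → Reachable G u v

Acyclic : ∀ {k} → Graph k → Set
Acyclic G = ∀ k → 3 ≤ k → ¬ Contains G (cycle k)

IsTree : ∀ {k} → Graph k → Set
IsTree G = IsSimple G × Connected G × Acyclic G

degree : ∀ {k} → Graph k → Fin k → ℕ
degree {k} G v = sum (map (λ u → if G v u then 1 else 0) (allFin k))

MaxDegreeIs : ∀ {k} → Graph k → ℕ → Set
MaxDegreeIs G d = (∃ λ v → degree G v ≡ d) × (∀ v → degree G v ≤ d)

RamseyProp : ∀ {p q} → Graph p → Graph q → ℕ → Set
RamseyProp G H N = (F : Graph N) → IsSimple F → Contains F G ⊎ Contains (complement F) H

RamseyAtLeast : ∀ {p q} → Graph p → Graph q → ℕ → Set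
RamseyAtLeast G H K = ∀ N → N < K → ¬ RamseyProp G H N

-- Write m = 2k, n = 2 + qk and r = k − 1. For q ≥ 1 colour the pairs of N₀ = 2n + k − 5 vertices
-- so that the blue graph consists of an independent set A of n − 1 vertices joined to everything
-- else, q − 1 disjoint cliques K_k and one K_{r,r}; the red graph is the rest.
-- Red contains no T_n: red edges never leave A, which has only n − 1 vertices, and outside A every
-- vertex has red degree n − 4 < Δ(T_n).
-- Blue contains no W_{2k}: if the hub lies in A, the rim is a blue cycle outside A, hence inside
-- a single clique or the K_{r,r}, each of fewer than 2k vertices. Otherwise the rim vertices in A
-- are never consecutive; charging each to its successor, the 2k rim vertices inject into two
-- copies of the hub's blue neighbours outside A, of which there are only r.

module Submission where

open import Defs
open import Data.Bool using (Bool; true; false; not; _∧_; _∨_; if_then_else_)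
open import Data.Bool.Properties using (∨-comm; ∨-zeroʳ; ∧-identityʳ; ∧-zeroʳ; T-≡)
open import Data.Empty using (⊥; ⊥-elim)
open import Data.Fin as Fin using (Fin; zero; suc; toℕ; fromℕ<; inject≤; splitAt; join; punchOut)
open import Data.Fin.Properties
  using (+↔⊎; *↔×; injective⇒≤; inject≤-injective; splitAt-join; join-splitAt; punchOut-injective; punchInᵢ≢i;
         0≢1+n; toℕ-fromℕ<; fromℕ<-toℕ; toℕ-injective; toℕ<n; suc-injective)
open import Data.List using (map; tabulate)
open import Data.List.Properties using (map-tabulate)
open import Data.Maybe using (Maybe; just; nothing)
open import Data.Maybe.Properties using (just-injective)
open import Data.Nat using (ℕ; zero; suc; _+_; _*_; _∸_; _≤_; _<_; _≡ᵇ_; _/_; z≤n; s≤s)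
open import Data.Nat.Divisibility using (_∣_; divides)
open import Data.Nat.DivMod using (m*n/n≡m)
open import Data.Nat.ListAction using (sum)
open import Data.Nat.Properties as ℕ
  using (≡⇒≡ᵇ; +-suc; 1+n≰n; ≤-pred; ≮⇒≥; ≤-antisym; <-trans; n<1+n; m≤n+m; m+n∸m≡n; *-cancelʳ-≤)
open import Data.Nat.Tactic.RingSolver using (solve-∀)
open import Data.Product using (Σ; ∃; _×_; _,_; proj₁; proj₂)
open import Data.Sum using (_⊎_; inj₁; inj₂; [_,_]′)
open import Data.Sum.Function.Propositional using (_⊎-↔_)
open import Data.Sum.Properties using (inj₁-injective; inj₂-injective)
open import Function using (_∘_; Injective; Inverse; Injection; _↔_)
open import Function.Bundles using (Equivalence)
open import Function.Properties.Inverse using (↔-refl; ↔-sym; ↔-trans; ↔⇒↣)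
open import Relation.Nullary using (¬_; yes; no; does)
open import Relation.Nullary.Decidable using (⌊_⌋; dec-true; dec-false)
open import Relation.Binary.PropositionalEquality
  using (_≡_; _≢_; refl; sym; trans; cong; subst; module ≡-Reasoning)

count : ∀ {n} → (Fin n → Bool) → ℕ
count {zero}  P = 0
count {suc n} P = (if P zero then 1 else 0) + count (P ∘ suc)

count-cong : ∀ {n} {P Q : Fin n → Bool} → (∀ i → P i ≡ Q i) → count P ≡ count Q
count-cong {zero}  P≗Q = refl
count-cong {suc n} P≗Q rewrite P≗Q zero = cong (_ +_) (count-cong (P≗Q ∘ suc))

degree≡count : ∀ {n} (G : Graph n) v → degree G v ≡ count (G v)
degree≡count G v = trans (cong sum (map-tabulate (λ u → u) (λ u → if G v u then 1 else 0))) (sum-indicator (G v))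
  where
  sum-indicator : ∀ {n} (P : Fin n → Bool) → sum (tabulate (λ u → if P u then 1 else 0)) ≡ count P
  sum-indicator {zero}  P = refl
  sum-indicator {suc n} P = cong ((if P zero then 1 else 0) +_) (sum-indicator (P ∘ suc))

count-complement : ∀ {n} (P : Fin n → Bool) → count P + count (not ∘ P) ≡ n
count-complement {zero}  P = refl
count-complement {suc n} P with P zero
... | true  = cong suc (count-complement (P ∘ suc))
... | false = trans (+-suc _ _) (cong suc (count-complement (P ∘ suc)))

count-remove : ∀ {n} (Q : Fin n → Bool) (w : Fin n) → Q w ≡ true →
               count Q ≡ suc (count (λ u → Q u ∧ not (does (u Fin.≟ w))))
count-remove Q zero Qw rewrite Qw = cong suc (count-cong (λ u → sym (∧-identityʳ (Q (suc u)))))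
count-remove Q (suc w) Qw with Q zero
... | true  = cong suc (count-remove (Q ∘ suc) w Qw)
... | false = count-remove (Q ∘ suc) w Qw

count-mono : ∀ {m n} (P : Fin m → Bool) (Q : Fin n → Bool) (f : Fin m → Fin n) →
             (∀ {i j} → P i ≡ true → P j ≡ true → f i ≡ f j → i ≡ j) →
             (∀ {i} → P i ≡ true → Q (f i) ≡ true) →
             count P ≤ count Q
count-mono {zero}  P Q f f-inj f-hom = z≤n
count-mono {suc m} P Q f f-inj f-hom with P zero in P0
... | false = count-mono (P ∘ suc) Q (f ∘ suc) (λ Pi Pj → suc-injective ∘ f-inj Pi Pj) f-hom
... | true rewrite count-remove Q (f zero) (f-hom P0) =
  s≤s (count-mono (P ∘ suc) _ (f ∘ suc) (λ Pi Pj → suc-injective ∘ f-inj Pi Pj) hom′)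
  where
  hom′ : ∀ {i} → P (suc i) ≡ true → Q (f (suc i)) ∧ not (does (f (suc i) Fin.≟ f zero)) ≡ true
  hom′ {i} Pi rewrite f-hom Pi | dec-false (f (suc i) Fin.≟ f zero) (0≢1+n ∘ sym ∘ f-inj Pi P0) = refl

injection⇒≤count : ∀ {t n} (Q : Fin n → Bool) (g : Fin t → Fin n) → Injective _≡_ _≡_ g →
                   (∀ i → Q (g i) ≡ true) → t ≤ count Q
injection⇒≤count {t} Q g g-inj Qg =
  subst (_≤ count Q) (count-const-true t) (count-mono (λ _ → true) Q g (λ _ _ → g-inj) (λ {i} _ → Qg i))
  where
  count-const-true : ∀ t → count {t} (λ _ → true) ≡ t
  count-const-true zero    = refl
  count-const-true (suc t) = cong suc (count-const-true t)

degree-+-nonNeighbours : ∀ {N t} (F : Graph N) (u : Fin N) (g : Fin t → Fin N) →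
                         Injective _≡_ _≡_ g → (∀ i → F u (g i) ≡ false) → degree F u + t ≤ N
degree-+-nonNeighbours {N} {t} F u g g-inj non-adjacent = begin
  degree F u + t                  ≤⟨ ℕ.+-monoʳ-≤ (degree F u) t≤nonDegree ⟩
  degree F u + count (not ∘ F u)  ≡⟨ cong (_+ count (not ∘ F u)) (degree≡count F u) ⟩
  count (F u) + count (not ∘ F u) ≡⟨ count-complement (F u) ⟩
  N                               ∎
  where
  open ℕ.≤-Reasoning
  t≤nonDegree : t ≤ count (not ∘ F u)
  t≤nonDegree = injection⇒≤count (not ∘ F u) g g-inj (λ i → cong not (non-adjacent i))

degree-≤-Contains : ∀ {p N} {F : Graph N} {G : Graph p} (G⊆F : Contains F G) v →
                    degree G v ≤ degree F (proj₁ G⊆F v)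
degree-≤-Contains {F = F} {G} (f , f-inj , f-hom) v = begin
  degree G v         ≡⟨ degree≡count G v ⟩
  count (G v)        ≤⟨ count-mono (G v) (F (f v)) f (λ _ _ → f-inj) (f-hom v _) ⟩
  count (F (f v))    ≡⟨ degree≡count F (f v) ⟨
  degree F (f v)     ∎
  where open ℕ.≤-Reasoning

Connected-degree-pos : ∀ {n} {G : Graph n} → Connected G → ∀ {u v} → u ≢ v → 1 ≤ degree G u
Connected-degree-pos {G = G} G-connected {u} {v} u≢v with G-connected u v
... | here = ⊥-elim (u≢v refl)
... | step {w = w} uw _ =
  subst (1 ≤_) (sym (degree≡count G u)) (injection⇒≤count (G u) (λ _ → w) (λ { {zero} {zero} _ → refl }) (λ _ → uw))

Contains-reachable-closed : ∀ {p N} {F : Graph N} {G : Graph p} (P : Fin N → Set) →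
                            (∀ u v → F u v ≡ true → P u → P v) →
                            ((f , _) : Contains F G) → ∀ {u v} → Reachable G u v → P (f u) → P (f v)
Contains-reachable-closed P P-closed G⊆F here          Pu = Pu
Contains-reachable-closed P P-closed G⊆F (step uw wv) Pu =
  Contains-reachable-closed P P-closed G⊆F wv (P-closed _ _ (proj₂ (proj₂ G⊆F) _ _ uw) Pu)

Contains-trans : ∀ {p q N} {F : Graph N} {G : Graph q} {K : Graph p} → Contains F G → Contains G K → Contains F K
Contains-trans (f , f-inj , f-hom) (g , g-inj , g-hom) =
  f ∘ g , g-inj ∘ f-inj , λ u v uv → f-hom (g u) (g v) (g-hom u v uv)

induced : ∀ {M N} → Graph N → (Fin M → Fin N) → Graph M
induced F ι u v = F (ι u) (ι v)

complement-induced : ∀ {M N} (F : Graph N) {ι : Fin M → Fin N} → Injective _≡_ _≡_ ι →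
                     ∀ u v → complement (induced F ι) u v ≡ complement F (ι u) (ι v)
complement-induced F {ι} ι-inj u v with u Fin.≟ v | ι u Fin.≟ ι v
... | yes _   | yes _     = refl
... | no _    | no _      = refl
... | yes u≡v | no ιu≢ιv  = ⊥-elim (ιu≢ιv (cong ι u≡v))
... | no u≢v  | yes ιu≡ιv = ⊥-elim (u≢v (ι-inj ιu≡ιv))

RamseyAtLeast-witness : ∀ {p q N} {G : Graph p} {H : Graph q} (F : Graph N) → IsSimple F →
                        ¬ Contains F G → ¬ Contains (complement F) H → RamseyAtLeast G H (suc N)
RamseyAtLeast-witness F (F-sym , F-loopless) G⊈F H⊈F̄ N′ (s≤s N′≤N) N′-Ramsey =
  [ G⊈F ∘ Contains-trans {F = F} (ι , ι-inj , λ _ _ e → e)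
  , H⊈F̄ ∘ Contains-trans {F = complement F} (ι , ι-inj , λ u v e → trans (sym (complement-induced F ι-inj u v)) e)
  ]′ (N′-Ramsey (induced F ι) ((λ u v → F-sym (ι u) (ι v)) , F-loopless ∘ ι))
  where
  ι : Fin N′ → Fin _
  ι u = inject≤ u N′≤N
  ι-inj : Injective _≡_ _≡_ ι
  ι-inj = inject≤-injective N′≤N N′≤N _ _

module RedGraph {N} {V : Set} (e : Fin N ↔ V) (blue : V → V → Bool) where

  open Inverse e using (to; from; strictlyInverseˡ)

  to-injective : Injective _≡_ _≡_ to
  to-injective = Injection.injective (↔⇒↣ e)

  from-injective : Injective _≡_ _≡_ from
  from-injective = Injection.injective (↔⇒↣ (↔-sym e))

  redGraph : Graph N
  redGraph u v = not (blue (to u) (to v)) ∧ not ⌊ u Fin.≟ v ⌋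

  redGraph-simple : (∀ x y → blue x y ≡ blue y x) → IsSimple redGraph
  redGraph-simple blue-sym = red-sym , red-loopless
    where
    red-sym : ∀ u v → redGraph u v ≡ redGraph v u
    red-sym u v rewrite blue-sym (to u) (to v) with u Fin.≟ v | v Fin.≟ u
    ... | yes _   | yes _   = refl
    ... | no _    | no _    = refl
    ... | yes u≡v | no v≢u  = ⊥-elim (v≢u (sym u≡v))
    ... | no u≢v  | yes v≡u = ⊥-elim (u≢v (sym v≡u))
    red-loopless : ∀ v → redGraph v v ≡ false
    red-loopless v with v Fin.≟ v
    ... | yes _   = ∧-zeroʳ _
    ... | no v≢v  = ⊥-elim (v≢v refl)

  redGraph-edge : ∀ {u v} → redGraph u v ≡ true → blue (to u) (to v) ≡ false
  redGraph-edge {u} {v} red with blue (to u) (to v)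
  ... | false = refl

  complement-redGraph-edge : ∀ {u v} → complement redGraph u v ≡ true → blue (to u) (to v) ≡ true
  complement-redGraph-edge {u} {v} blue-uv with blue (to u) (to v) | u Fin.≟ v
  ... | true  | _     = refl
  complement-redGraph-edge () | false | yes _
  complement-redGraph-edge () | false | no _

  redGraph-degree-bound : ∀ {t} u (ν : Fin t → V) → Injective _≡_ _≡_ ν →
                          (∀ i → ν i ≡ to u ⊎ blue (to u) (ν i) ≡ true) → degree redGraph u + t ≤ N
  redGraph-degree-bound u ν ν-inj self-or-blue =
    degree-+-nonNeighbours redGraph u (from ∘ ν) (ν-inj ∘ from-injective) non-adjacent
    where
    non-adjacent : ∀ i → redGraph u (from (ν i)) ≡ false
    non-adjacent i with self-or-blue i | u Fin.≟ from (ν i)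
    ... | _          | yes _   = ∧-zeroʳ _
    ... | inj₁ νi≡u  | no u≢νi = ⊥-elim (u≢νi (to-injective (trans (sym νi≡u) (sym (strictlyInverseˡ (ν i))))))
    ... | inj₂ blue′ | no _    rewrite strictlyInverseˡ (ν i) | blue′ = refl

  Contains-complement-redGraph : ∀ {p} {G : Graph p} → Contains (complement redGraph) G →
    Σ (Fin p → V) λ φ → Injective _≡_ _≡_ φ × (∀ u v → G u v ≡ true → blue (φ u) (φ v) ≡ true)
  Contains-complement-redGraph (g , g-inj , g-hom) =
    to ∘ g , g-inj ∘ to-injective , λ u v uv → complement-redGraph-edge (g-hom u v uv)

next : ∀ {M} → Fin (suc M) → Fin (suc M)
next {M} i with suc (toℕ i) ℕ.<? suc M
... | yes i+1<1+M = fromℕ< i+1<1+M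
... | no _        = zero

toℕ-next : ∀ {M} (i : Fin (suc M)) → suc (toℕ i) < suc M → toℕ (next i) ≡ suc (toℕ i)
toℕ-next {M} i i+1<1+M with suc (toℕ i) ℕ.<? suc M
... | yes i+1<1+M′ = toℕ-fromℕ< i+1<1+M′
... | no i+1≮1+M   = ⊥-elim (i+1≮1+M i+1<1+M)

toℕ-last : ∀ {M} (i : Fin (suc M)) → ¬ suc (toℕ i) < suc M → toℕ i ≡ M
toℕ-last i i+1≮1+M = ≤-antisym (≤-pred (toℕ<n i)) (≤-pred (≮⇒≥ i+1≮1+M))

≡ᵇ-refl : ∀ n → (n ≡ᵇ n) ≡ true
≡ᵇ-refl n = Equivalence.to T-≡ (≡⇒≡ᵇ n n refl)

cycle-step : ∀ {N} (i j : Fin N) → toℕ j ≡ suc (toℕ i) → cycle N i j ≡ true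
cycle-step i j j≡i+1 rewrite j≡i+1 | ≡ᵇ-refl (toℕ i) = refl

cycle-wrap : ∀ {M} (i : Fin (suc M)) → toℕ i ≡ M → cycle (suc M) i zero ≡ true
cycle-wrap {M} i i≡M rewrite i≡M | ≡ᵇ-refl M = trans (cong ((1 ≡ᵇ M) ∨_) (∨-zeroʳ _)) (∨-zeroʳ _)

cycle-next : ∀ {M} (i : Fin (suc M)) → cycle (suc M) i (next i) ≡ true
cycle-next {M} i with suc (toℕ i) ℕ.<? suc M
... | yes i+1<1+M = cycle-step i _ (toℕ-fromℕ< i+1<1+M)
... | no i+1≮1+M  = cycle-wrap i (toℕ-last i i+1≮1+M)

next-injective : ∀ {M} (i j : Fin (suc M)) → next i ≡ next j → i ≡ j
next-injective {M} i j with suc (toℕ i) ℕ.<? suc M | suc (toℕ j) ℕ.<? suc M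
... | yes i+1<1+M | yes j+1<1+M = λ eq →
  toℕ-injective (ℕ.suc-injective (trans (sym (toℕ-fromℕ< i+1<1+M)) (trans (cong toℕ eq) (toℕ-fromℕ< j+1<1+M))))
... | no i+1≮1+M  | no j+1≮1+M  = λ _ → toℕ-injective (trans (toℕ-last i i+1≮1+M) (sym (toℕ-last j j+1≮1+M)))
... | yes i+1<1+M | no _        = λ eq → ⊥-elim (ℕ.0≢1+n (trans (sym (cong toℕ eq)) (toℕ-fromℕ< i+1<1+M)))
... | no _        | yes j+1<1+M = λ eq → ⊥-elim (ℕ.0≢1+n (trans (cong toℕ eq) (toℕ-fromℕ< j+1<1+M)))

next-fromℕ< : ∀ {M t} (t+1<1+M : suc t < suc M) →
              next (fromℕ< (<-trans (n<1+n t) t+1<1+M)) ≡ fromℕ< t+1<1+M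
next-fromℕ< {M} {t} t+1<1+M = toℕ-injective (begin
  toℕ (next (fromℕ< t<1+M))   ≡⟨ toℕ-next _ (subst (λ x → suc x < suc M) (sym (toℕ-fromℕ< t<1+M)) t+1<1+M) ⟩
  suc (toℕ (fromℕ< t<1+M))    ≡⟨ cong suc (toℕ-fromℕ< t<1+M) ⟩
  suc t                        ≡⟨ toℕ-fromℕ< t+1<1+M ⟨
  toℕ (fromℕ< t+1<1+M)        ∎)
  where
  open ≡-Reasoning
  t<1+M : t < suc M
  t<1+M = <-trans (n<1+n t) t+1<1+M

next-invariant⇒constant : ∀ {M} {A : Set} (L : Fin (suc M) → A) → (∀ i → L (next i) ≡ L i) → ∀ i → L i ≡ L zero
next-invariant⇒constant {M} L L-invariant i =
  trans (cong L (sym (fromℕ<-toℕ i (toℕ<n i)))) (from-zero (toℕ i) (toℕ<n i))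
  where
  from-zero : ∀ t (t<1+M : t < suc M) → L (fromℕ< t<1+M) ≡ L zero
  from-zero zero    _        = refl
  from-zero (suc t) t+1<1+M = begin
    L (fromℕ< t+1<1+M)         ≡⟨ cong L (next-fromℕ< t+1<1+M) ⟨
    L (next (fromℕ< t<1+M))    ≡⟨ L-invariant (fromℕ< t<1+M) ⟩
    L (fromℕ< t<1+M)           ≡⟨ from-zero t t<1+M ⟩
    L zero                     ∎
    where
    open ≡-Reasoning
    t<1+M : t < suc M
    t<1+M = <-trans (n<1+n t) t+1<1+M

join-injective : ∀ m n → Injective _≡_ _≡_ (join m n)
join-injective m n {x} {y} eq = trans (sym (splitAt-join m n x)) (trans (cong (splitAt m) eq) (splitAt-join m n y))

splitAt-injective : ∀ m n → Injective _≡_ _≡_ (splitAt m {n})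
splitAt-injective m n {x} {y} eq = trans (sym (join-splitAt m n x)) (trans (cong (join m n) eq) (join-splitAt m n y))

-- Each marked term is charged to its successor, which is unmarked.
cyclic-sparse-marks-bound : ∀ {M r} (marked : Fin (suc M) → Bool) (idx : Fin (suc M) → Fin r) →
  (∀ i → marked i ≡ true → marked (next i) ≡ false) →
  (∀ {i j} → marked i ≡ false → marked j ≡ false → idx i ≡ idx j → i ≡ j) →
  suc M ≤ r + r
cyclic-sparse-marks-bound {M} {r} marked idx sparse idx-inj =
  injective⇒≤ (λ {i} {j} → slot-injective i j ∘ join-injective r r)
  where
  slot : Fin (suc M) → Fin r ⊎ Fin r
  slot i with marked i
  ... | true  = inj₂ (idx (next i))
  ... | false = inj₁ (idx i)

  slot-injective : ∀ i j → slot i ≡ slot j → i ≡ j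
  slot-injective i j with marked i in mi | marked j in mj
  ... | false | false = idx-inj mi mj ∘ inj₁-injective
  ... | true  | true  = next-injective i j ∘ idx-inj (sparse i mi) (sparse j mj) ∘ inj₂-injective
  ... | false | true  = λ ()
  ... | true  | false = λ ()

module Construction (p r′ : ℕ) where

  r k a N₀ : ℕ
  r  = suc r′
  k  = suc r
  a  = suc (suc p * k)
  N₀ = a + (p * k + (r + r))

  V : Set
  V = Fin a ⊎ (Fin p × Fin k) ⊎ (Fin r ⊎ Fin r)

  -- A = vA _, the q − 1 blue cliques vC c _, and the sides vD₀ _ and vD₁ _ of the blue K_{r,r}.
  pattern vA i   = inj₁ i
  pattern vC c j = inj₂ (inj₁ (c , j))
  pattern vD d   = inj₂ (inj₂ d)
  pattern vD₀ j  = inj₂ (inj₂ (inj₁ j))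
  pattern vD₁ j  = inj₂ (inj₂ (inj₂ j))

  Fin↔V : Fin N₀ ↔ V
  Fin↔V = ↔-trans +↔⊎ (↔-refl ⊎-↔ ↔-trans +↔⊎ (*↔× ⊎-↔ +↔⊎))

  blue→ : V → V → Bool
  blue→ (vA _)   (vA _)    = false
  blue→ (vA _)   _         = true
  blue→ (vC c _) (vC c′ _) = does (c Fin.≟ c′)
  blue→ (vD₀ _)  (vD₁ _)   = true
  blue→ _        _         = false

  -- blue is reflexive on the cliques; this is harmless, as redGraph never consults it on loops.
  blue : V → V → Bool
  blue x y = blue→ x y ∨ blue→ y x

  blue-sym : ∀ x y → blue x y ≡ blue y x
  blue-sym x y = ∨-comm (blue→ x y) (blue→ y x)

  open RedGraph Fin↔V blue
  open Inverse Fin↔V using (to)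

  isA : V → Bool
  isA (vA _) = true
  isA _      = false

  red-from-A : ∀ {i y} → blue (vA i) y ≡ false → ∃ λ j → y ≡ vA j
  red-from-A {y = vA j} _ = j , refl

  A-independent : ∀ {x y} → isA x ≡ true → blue x y ≡ true → isA y ≡ false
  A-independent {vA _} {vA _}   _ ()
  A-independent {vA _} {inj₂ _} _ _ = refl

  blue-to-A : ∀ {x} i → isA x ≡ false → blue x (vA i) ≡ true
  blue-to-A {vC _ _} _ _ = refl
  blue-to-A {vD₀ _}  _ _ = refl
  blue-to-A {vD₁ _}  _ _ = refl

  blue-clique : ∀ c j j′ → blue (vC c j) (vC c j′) ≡ true
  blue-clique c j j′ rewrite dec-true (c Fin.≟ c) refl = refl

  data BlueEdge : V → V → Set where
    same-clique : ∀ {c j j′} → BlueEdge (vC c j) (vC c j′)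
    across₀₁    : ∀ {j j′} → BlueEdge (vD₀ j) (vD₁ j′)
    across₁₀    : ∀ {j j′} → BlueEdge (vD₁ j) (vD₀ j′)

  blueEdge : ∀ {x y} → isA x ≡ false → isA y ≡ false → blue x y ≡ true → BlueEdge x y
  blueEdge {vC c _} {vC c′ _} _ _ cc′ with c Fin.≟ c′ | c′ Fin.≟ c
  ... | yes refl | _        = same-clique
  ... | no _     | yes refl = same-clique
  blueEdge {vC _ _} {vD₀ _} _ _ ()
  blueEdge {vC _ _} {vD₁ _} _ _ ()
  blueEdge {vD₀ _} {vD₁ _} _ _ _ = across₀₁
  blueEdge {vD₁ _} {vD₀ _} _ _ _ = across₁₀

  block : V → Maybe (Fin p)
  block (vC c _) = just c
  block _        = nothing

  BlueEdge-block : ∀ {x y} → BlueEdge x y → block x ≡ block y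
  BlueEdge-block same-clique = refl
  BlueEdge-block across₀₁    = refl
  BlueEdge-block across₁₀    = refl

  blockIndex : V → Fin (r + r)
  blockIndex (vA _)   = zero
  blockIndex (vC _ j) = inject≤ j (s≤s (m≤n+m r r′))
  blockIndex (vD d)   = join r r d

  blockIndex-injective : ∀ {x y} → isA x ≡ false → isA y ≡ false → block x ≡ block y →
                         blockIndex x ≡ blockIndex y → x ≡ y
  blockIndex-injective {vC c j} {vC c′ j′} _ _ cc′ jj′
    rewrite just-injective cc′ | inject≤-injective _ _ j j′ jj′ = refl
  blockIndex-injective {vD d}   {vD d′}    _ _ _  dd′ = cong (λ d → vD d) (join-injective r r dd′)

  hubIndex : V → V → Fin r
  hubIndex (vC _ j₀) (vC _ j) with j₀ Fin.≟ j
  ... | no j₀≢j = punchOut j₀≢j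
  ... | yes _   = zero
  hubIndex (vD₀ _)   (vD₁ j)  = j
  hubIndex (vD₁ _)   (vD₀ j)  = j
  hubIndex _         _        = zero

  hubIndex-injective : ∀ {h x y} → BlueEdge h x → BlueEdge h y → x ≢ h → y ≢ h →
                       hubIndex h x ≡ hubIndex h y → x ≡ y
  hubIndex-injective (same-clique {c} {j₀} {j}) (same-clique {j′ = j′}) x≢h y≢h
    with j₀ Fin.≟ j | j₀ Fin.≟ j′
  ... | no j₀≢j  | no j₀≢j′ = λ eq → cong (λ t → vC c t) (punchOut-injective j₀≢j j₀≢j′ eq)
  ... | yes refl | _        = ⊥-elim (x≢h refl)
  ... | no _     | yes refl = ⊥-elim (y≢h refl)
  hubIndex-injective across₀₁ across₀₁ _ _ refl = refl
  hubIndex-injective across₁₀ across₁₀ _ _ refl = refl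

  localBlock : V → Fin k → V
  localBlock (vA i)   _       = vA i
  localBlock (vC c _) t       = vC c t
  localBlock (vD₀ j)  zero    = vD₀ j
  localBlock (vD₀ _)  (suc t) = vD₁ t
  localBlock (vD₁ j)  zero    = vD₁ j
  localBlock (vD₁ _)  (suc t) = vD₀ t

  localBlock-injective : ∀ {x} → isA x ≡ false → Injective _≡_ _≡_ (localBlock x)
  localBlock-injective {vC _ _} _ {t} {t′} refl = refl
  localBlock-injective {vD₀ _}  _ {zero}  {zero}  _    = refl
  localBlock-injective {vD₀ _}  _ {suc t} {suc t′} refl = refl
  localBlock-injective {vD₁ _}  _ {zero}  {zero}  _    = refl
  localBlock-injective {vD₁ _}  _ {suc t} {suc t′} refl = refl

  localBlock-outside-A : ∀ {x} → isA x ≡ false → ∀ t → isA (localBlock x t) ≡ false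
  localBlock-outside-A {vC _ _} _ _       = refl
  localBlock-outside-A {vD₀ _}  _ zero    = refl
  localBlock-outside-A {vD₀ _}  _ (suc _) = refl
  localBlock-outside-A {vD₁ _}  _ zero    = refl
  localBlock-outside-A {vD₁ _}  _ (suc _) = refl

  localBlock-self-or-blue : ∀ {x} → isA x ≡ false → ∀ t → localBlock x t ≡ x ⊎ blue x (localBlock x t) ≡ true
  localBlock-self-or-blue {vC c j} _ t       = inj₂ (blue-clique c j t)
  localBlock-self-or-blue {vD₀ _}  _ zero    = inj₁ refl
  localBlock-self-or-blue {vD₀ _}  _ (suc _) = inj₂ refl
  localBlock-self-or-blue {vD₁ _}  _ zero    = inj₁ refl
  localBlock-self-or-blue {vD₁ _}  _ (suc _) = inj₂ refl

  red-degree-outside-A : ∀ u → isA (to u) ≡ false → degree redGraph u + (a + k) ≤ N₀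
  red-degree-outside-A u u∉A =
    redGraph-degree-bound u (nonNeighbour ∘ splitAt a) (splitAt-injective a k ∘ nonNeighbour-injective) self-or-blue
    where
    nonNeighbour : Fin a ⊎ Fin k → V
    nonNeighbour = [ vA , localBlock (to u) ]′

    nonNeighbour-injective : Injective _≡_ _≡_ nonNeighbour
    nonNeighbour-injective {inj₁ _} {inj₁ _} refl = refl
    nonNeighbour-injective {inj₂ _} {inj₂ _} eq   = cong inj₂ (localBlock-injective u∉A eq)
    nonNeighbour-injective {inj₁ _} {inj₂ t} eq   with () ← trans (cong isA eq) (localBlock-outside-A u∉A t)
    nonNeighbour-injective {inj₂ t} {inj₁ _} eq   with () ← trans (sym (cong isA eq)) (localBlock-outside-A u∉A t)

    self-or-blue : ∀ w → nonNeighbour (splitAt a w) ≡ to u ⊎ blue (to u) (nonNeighbour (splitAt a w)) ≡ true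
    self-or-blue w with splitAt a w
    ... | inj₁ i = inj₂ (blue-to-A i u∉A)
    ... | inj₂ t = localBlock-self-or-blue u∉A t

  InA : Fin N₀ → Set
  InA u = ∃ λ i → to u ≡ vA i

  red-closed-in-A : ∀ u v → redGraph u v ≡ true → InA u → InA v
  red-closed-in-A u v red (i , u∈A) =
    red-from-A (subst (λ x → blue x (to v) ≡ false) u∈A (redGraph-edge {u} {v} red))

  degree-arithmetic : (r + p * k) + (a + k) ≡ suc N₀
  degree-arithmetic = arith p r′
    where
    arith : ∀ p r′ → (suc r′ + p * suc (suc r′)) + (suc (suc p * suc (suc r′)) + suc (suc r′))
                     ≡ suc (suc (suc p * suc (suc r′)) + (p * suc (suc r′) + (suc r′ + suc r′)))
    arith = solve-∀

  no-red-tree : (T : Graph (suc a)) → Connected T → (∃ λ c → degree T c ≡ r + p * k) → ¬ Contains redGraph T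
  no-red-tree T T-connected (c , deg-c) T⊆F@(f , f-inj , _) with to (f c) in fc∈A
  ... | vA i = 1+n≰n (injective⇒≤ A-position-injective)
    where
    inA : ∀ v → InA (f v)
    inA v = Contains-reachable-closed {F = redGraph} {G = T} InA red-closed-in-A T⊆F (T-connected c v) (i , fc∈A)
    A-position-injective : Injective _≡_ _≡_ (proj₁ ∘ inA)
    A-position-injective {v} {w} eq =
      f-inj (to-injective (trans (proj₂ (inA v)) (trans (cong vA eq) (sym (proj₂ (inA w))))))
  ... | inj₂ _ = ℕ.<-irrefl refl (begin-strict
    N₀                               <⟨ n<1+n N₀ ⟩
    suc N₀                           ≡⟨ degree-arithmetic ⟨
    (r + p * k) + (a + k)            ≡⟨ cong (_+ (a + k)) deg-c ⟨
    degree T c + (a + k)             ≤⟨ ℕ.+-monoˡ-≤ (a + k) (degree-≤-Contains {F = redGraph} {G = T} T⊆F c) ⟩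
    degree redGraph (f c) + (a + k)  ≤⟨ red-degree-outside-A (f c) (cong isA fc∈A) ⟩
    N₀                               ∎)
    where open ℕ.≤-Reasoning

  no-blue-wheel : (ψ : Fin (suc (k * 2)) → V) → Injective _≡_ _≡_ ψ →
                  (∀ u v → wheel (k * 2) u v ≡ true → blue (ψ u) (ψ v) ≡ true) → ⊥
  no-blue-wheel ψ ψ-inj ψ-blue = rim-too-long (rim-length-bound (isA hub) refl)
    where
    hub : V
    hub = ψ zero

    rim : Fin (k * 2) → V
    rim = ψ ∘ suc

    rim-injective : Injective _≡_ _≡_ rim
    rim-injective = suc-injective ∘ ψ-inj

    rim≢hub : ∀ i → rim i ≢ hub
    rim≢hub i = 0≢1+n ∘ sym ∘ ψ-inj

    spoke : ∀ i → blue hub (rim i) ≡ true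
    spoke i = ψ-blue zero (suc i) refl

    rim-edge : ∀ i → blue (rim i) (rim (next i)) ≡ true
    rim-edge i = ψ-blue (suc i) (suc (next i)) (cycle-next i)

    rim-length-bound : ∀ b → isA hub ≡ b → k * 2 ≤ r + r
    rim-length-bound false hub∉A =
      cyclic-sparse-marks-bound (isA ∘ rim) (hubIndex hub ∘ rim) (λ i i∈A → A-independent i∈A (rim-edge i))
        (λ {i} {j} i∉A j∉A → rim-injective ∘
          hubIndex-injective (blueEdge hub∉A i∉A (spoke i)) (blueEdge hub∉A j∉A (spoke j)) (rim≢hub i) (rim≢hub j))
    rim-length-bound true hub∈A =
      injective⇒≤ (λ {i} {j} → rim-injective ∘ blockIndex-injective (rim∉A i) (rim∉A j) (same-block i j))
      where
      rim∉A : ∀ i → isA (rim i) ≡ false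
      rim∉A i = A-independent hub∈A (spoke i)
      same-block : ∀ i j → block (rim i) ≡ block (rim j)
      same-block i j = trans (block-constant i) (sym (block-constant j))
        where
        block-constant : ∀ i → block (rim i) ≡ block (rim zero)
        block-constant = next-invariant⇒constant (block ∘ rim)
          (λ i → sym (BlueEdge-block (blueEdge (rim∉A i) (rim∉A (next i)) (rim-edge i))))

    rim-too-long : ¬ (k * 2 ≤ r + r)
    rim-too-long 2k≤2r = 1+n≰n (ℕ.≤-trans (ℕ.n≤1+n _) (subst (_≤ r + r) (double r) 2k≤2r))
      where
      double : ∀ r → suc r * 2 ≡ suc (suc (r + r))
      double = solve-∀

  lower-bound : (T : Graph (suc a)) → Connected T → (∃ λ c → degree T c ≡ r + p * k) →
                RamseyAtLeast T (wheel (k * 2)) (suc N₀)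
  lower-bound T T-connected hub-degree =
    RamseyAtLeast-witness redGraph (redGraph-simple blue-sym) (no-red-tree T T-connected hub-degree)
      (λ W⊆blue → let ψ , ψ-inj , ψ-blue = Contains-complement-redGraph W⊆blue in no-blue-wheel ψ ψ-inj ψ-blue)

tree-wheel-lower-bound : ∀ k q → 2 ≤ k → (T : Graph (2 + q * k)) → Connected T →
                         (∃ λ c → degree T c ≡ (2 + q * k) ∸ 3) →
                         RamseyAtLeast T (wheel (k * 2)) (2 * (2 + q * k) + k ∸ 4)
tree-wheel-lower-bound (suc zero) _ (s≤s ())
-- For q = 0 the degree hypothesis reads degree T c ≡ 2 ∸ 3 ≡ 0, impossible in a connected graph.
tree-wheel-lower-bound (suc (suc r′)) zero _ T T-connected (c , deg-c)
  with () ← subst (1 ≤_) deg-c (Connected-degree-pos T-connected (punchInᵢ≢i c zero ∘ sym))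
tree-wheel-lower-bound (suc (suc r′)) (suc p) _ T T-connected hub-degree =
  subst (RamseyAtLeast T (wheel _)) (sym (trans (cong (_∸ 4) (size p r′)) (m+n∸m≡n 4 _)))
    (Construction.lower-bound p r′ T T-connected hub-degree)
  where
  size : ∀ p r′ → 2 * (2 + suc p * suc (suc r′)) + suc (suc r′)
                  ≡ 4 + suc (suc (suc p * suc (suc r′)) + (p * suc (suc r′) + (suc r′ + suc r′)))
  size = solve-∀

theorem3 : (m n : ℕ) → 8 ≤ m → 2 ∣ m → 1 ≤ n
    → (∃ λ q → n ≡ 2 + q * (m / 2))
    → (T : Graph n) → IsTree T → MaxDegreeIs T (n ∸ 3)
    → RamseyAtLeast T (wheel m) (2 * n + m / 2 ∸ 4)
theorem3 m n 8≤m (divides k refl) _ (q , n≡2+qk) T (_ , T-connected , _) ((c , deg-c) , _)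
  rewrite m*n/n≡m k 2 {{_}} | n≡2+qk =
  tree-wheel-lower-bound k q (*-cancelʳ-≤ 2 k 2 (ℕ.≤-trans (ℕ.m≤m+n 4 4) 8≤m)) T T-connected (c , deg-c)
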